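{- Let $G$ be a graph such that $\alpha(G)\le 2$. Then $ChVD(G)=1$ if and only if $ChVS(G)=1$.
   Context: All graphs are finite, simple and undirected. $\alpha(G)$ is the maximum size of an independent set of $G$. A (vertex) split of a vertex $v$ of a graph $G$ chooses sets $A,B\subseteq N_G(v)$ with $A\cup B=N_G(v)$ and replaces $v$ by two new vertices $v_1,v_2$, where $v_1$ is adjacent exactly to $A$ and $v_2$ exactly to $B$ (all other adjacencies unchanged). A chordal graph is a graph with no induced cycle of length at least $4$. $ChVS(G)$ is the minimum length of a sequence of splits turning $G$ into a chordal graph, and $ChVD(G)$ is the minimum number of vertex deletions turning $G$ into a chordal graph. -}

module Defs where

open import Data.Nat using (ℕ; zero; suc; _≤_; _+_)
open import Data.Fin using (Fin; zero; suc; toℕ; punchIn)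
open import Data.Fin.Subset using (Subset; _∈_; ∣_∣)
open import Data.Bool using (Bool; true; false; _∨_)
open import Data.Product using (Σ; _×_; ∃)
open import Data.Sum using (_⊎_)
open import Relation.Nullary using (¬_)
open import Relation.Binary.PropositionalEquality using (_≡_; refl)
open import Function.Definitions using (Injective)
open import Function.Bundles using (_⇔_)

record Graph (n : ℕ) : Set where
  field
    adj   : Fin n → Fin n → Bool
    sym   : ∀ i j → adj i j ≡ adj j i
    irref : ∀ i → adj i i ≡ false
open Graph public

Independent : ∀ {n} → Graph n → Subset n → Set
Independent G S = ∀ i j → i ∈ S → j ∈ S → adj G i j ≡ false

αAtMost : ∀ {n} → Graph n → ℕ → Set
αAtMost {n} G k = (S : Subset n) → Independent G S → ∣ S ∣ ≤ k

CycAdj : (k : ℕ) → Fin k → Fin k → Set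
CycAdj k i j =
  (suc (toℕ i) ≡ toℕ j) ⊎ (suc (toℕ j) ≡ toℕ i)
  ⊎ ((toℕ i ≡ 0 × suc (toℕ j) ≡ k) ⊎ (toℕ j ≡ 0 × suc (toℕ i) ≡ k))

InducedCycle : ∀ {n} → Graph n → (k : ℕ) → Set
InducedCycle {n} G k =
  Σ (Fin k → Fin n) λ c →
    Injective _≡_ _≡_ c × (∀ i j → (adj G (c i) (c j) ≡ true) ⇔ CycAdj k i j)

Chordal : ∀ {n} → Graph n → Set
Chordal G = ¬ (Σ ℕ λ m → InducedCycle G (4 + m))

delete : ∀ {n} → Graph (suc n) → Fin (suc n) → Graph n
delete G v = record
  { adj   = λ i j → adj G (punchIn v i) (punchIn v j)
  ; sym   = λ i j → sym G (punchIn v i) (punchIn v j)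
  ; irref = λ i → irref G (punchIn v i)
  }

data ChVDAtMost : ∀ {n} → Graph n → ℕ → Set where
  done : ∀ {n k} {G : Graph n} → Chordal G → ChVDAtMost G k
  step : ∀ {n k} {G : Graph (suc n)} (v : Fin (suc n)) →
         ChVDAtMost (delete G v) k → ChVDAtMost G (suc k)

ChVDEq : ∀ {n} → Graph n → ℕ → Set
ChVDEq G k = ChVDAtMost G k × (∀ j → suc j ≤ k → ¬ ChVDAtMost G j)

-- Vertex split
-- Splitting v with A, B ⊆ N(v), A ∪ B = N(v) (encoded as A u ∨ B u ≡ adj v u
-- for every u). The new graph has vertex set Fin (2 + n):
--   zero          = v₁ (adjacent exactly to A)
--   suc zero      = v₂ (adjacent exactly to B)
--   suc (suc i)   = old vertex punchIn v i (old vertices other than v)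

SplitSets : ∀ {n} → Graph (suc n) → Fin (suc n) → (A B : Fin (suc n) → Bool) → Set
SplitSets G v A B = ∀ u → (A u ∨ B u) ≡ adj G v u

splitAdj : ∀ {n} → Graph (suc n) → Fin (suc n) → (A B : Fin (suc n) → Bool) →
           Fin (suc (suc n)) → Fin (suc (suc n)) → Bool
splitAdj G v A B zero          zero          = false
splitAdj G v A B zero          (suc zero)    = false
splitAdj G v A B zero          (suc (suc j)) = A (punchIn v j)
splitAdj G v A B (suc zero)    zero          = false
splitAdj G v A B (suc zero)    (suc zero)    = false
splitAdj G v A B (suc zero)    (suc (suc j)) = B (punchIn v j)
splitAdj G v A B (suc (suc i)) zero          = A (punchIn v i)
splitAdj G v A B (suc (suc i)) (suc zero)    = B (punchIn v i)
splitAdj G v A B (suc (suc i)) (suc (suc j)) = adj G (punchIn v i) (punchIn v j)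

splitSym : ∀ {n} (G : Graph (suc n)) v A B i j →
           splitAdj G v A B i j ≡ splitAdj G v A B j i
splitSym G v A B zero          zero          = refl
splitSym G v A B zero          (suc zero)    = refl
splitSym G v A B zero          (suc (suc j)) = refl
splitSym G v A B (suc zero)    zero          = refl
splitSym G v A B (suc zero)    (suc zero)    = refl
splitSym G v A B (suc zero)    (suc (suc j)) = refl
splitSym G v A B (suc (suc i)) zero          = refl
splitSym G v A B (suc (suc i)) (suc zero)    = refl
splitSym G v A B (suc (suc i)) (suc (suc j)) = sym G (punchIn v i) (punchIn v j)

splitIrref : ∀ {n} (G : Graph (suc n)) v A B i → splitAdj G v A B i i ≡ false
splitIrref G v A B zero          = refl
splitIrref G v A B (suc zero)    = refl
splitIrref G v A B (suc (suc i)) = irref G (punchIn v i)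

split : ∀ {n} → Graph (suc n) → Fin (suc n) → (A B : Fin (suc n) → Bool) →
        Graph (suc (suc n))
split G v A B = record
  { adj   = splitAdj G v A B
  ; sym   = splitSym G v A B
  ; irref = splitIrref G v A B
  }

data ChVSAtMost : ∀ {n} → Graph n → ℕ → Set where
  done : ∀ {n k} {G : Graph n} → Chordal G → ChVSAtMost G k
  step : ∀ {n k} {G : Graph (suc n)} (v : Fin (suc n)) (A B : Fin (suc n) → Bool) →
         SplitSets G v A B → ChVSAtMost (split G v A B) k → ChVSAtMost G (suc k)

ChVSEq : ∀ {n} → Graph n → ℕ → Set
ChVSEq G k = ChVSAtMost G k × (∀ j → suc j ≤ k → ¬ ChVSAtMost G j)

{-# OPTIONS --safe #-}
-- Deleting v and splitting v agree on the old vertices, so a chordal split of v gives a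
-- chordal G - v.  Conversely, let G - v be chordal.  If N(v) = A ∪ B with A and B cliques,
-- the split along A, B is chordal: v₁ and v₂ are simplicial, a simplicial vertex lies on
-- no induced cycle of length ≥ 4, and a cycle avoiding v₁, v₂ lives in G - v.  To cover
-- N(v) by two cliques, take non-adjacent a, b ∈ N(v) (if there are none, N(v) is a clique).
-- As α(G) ≤ 2, the non-neighbours of a form a clique P, those of b a clique Q, and every
-- other vertex of N(v) is a common neighbour of a and b; common neighbours of a and b in
-- N(v) are pairwise adjacent, as otherwise they would span an induced C₄ in G - v.  Let A
-- consist of P and of the common neighbours adjacent to all of P ∩ N(v).  The remaining
-- vertices form a clique: a non-edge x y with x ∈ Q and y missing some p ∈ P ∩ N(v) would
-- give the induced C₅ y a x p b in G - v.
module Submission where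

open import Defs
open import Data.Nat using (ℕ)
open import Data.Product using (_×_)

open import Data.Bool using (Bool; true; false; _∧_; _∨_; not)
import Data.Bool.Properties as Bool
open import Data.Empty using (⊥-elim)
open import Data.Fin using (Fin; zero; suc; toℕ; fromℕ<; punchIn; punchOut; Fin′; inject; compare; less; equal; greater)
import Data.Fin.Properties as Fin
open import Data.Fin.Subset using (Subset; ⁅_⁆; _∪_; _-_; ∣_∣) renaming (_∈_ to _∈ₛ_)
import Data.Fin.Subset.Properties as Subset
open import Data.Nat using (zero; suc; _+_; _≤_; _<_; z≤n; s≤s)
import Data.Nat.Properties as ℕ
open import Data.Product using (Σ; _,_; proj₁; proj₂)
open import Data.Sum using (_⊎_; inj₁; inj₂)
open import Data.Vec using (Vec; []; _∷_; lookup)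
open import Data.Vec.Relation.Unary.All using (All; []; _∷_)
open import Data.Vec.Relation.Unary.All.Properties using (lookup⁺)
open import Function using (_∘_)
open import Function.Bundles using (_⇔_; mk⇔; module Equivalence)
open import Function.Definitions using (Injective)
open import Relation.Binary.PropositionalEquality
  using (_≡_; _≢_; refl; trans; cong; cong₂; subst; subst₂; ≢-sym; module ≡-Reasoning)
  renaming (sym to ≡-sym)
open import Relation.Nullary using (¬_; Dec; yes; no; does; contradiction)
open import Relation.Nullary.Decidable
  using (_×-dec_; _⊎-dec_; _→-dec_; ¬?; dec-false; does-⇔; decidable-stable)

∧-∨-∧-not : ∀ b d → (b ∧ d) ∨ (b ∧ not d) ≡ b
∧-∨-∧-not b d = begin
  (b ∧ d) ∨ (b ∧ not d)  ≡⟨ ≡-sym (Bool.∧-distribˡ-∨ b d (not d)) ⟩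
  b ∧ (d ∨ not d)        ≡⟨ cong (b ∧_) (Bool.∨-inverseʳ d) ⟩
  b ∧ true               ≡⟨ Bool.∧-identityʳ b ⟩
  b                      ∎
  where open ≡-Reasoning

∧-does≡true : ∀ {P : Set} b (P? : Dec P) → b ∧ does P? ≡ true → b ≡ true × P
∧-does≡true true  (yes p) _ = refl , p
∧-does≡true true  (no _)  ()
∧-does≡true false _       ()

does≡true⇔ : ∀ {P : Set} (P? : Dec P) → does P? ≡ true ⇔ P
does≡true⇔ (yes p)  = mk⇔ (λ _ → p) (λ _ → refl)
does≡true⇔ (no ¬p) = mk⇔ (λ ()) (λ p → contradiction p ¬p)

Clique : ∀ {n} → Graph n → (Fin n → Bool) → Set
Clique G C = ∀ x y → C x ≡ true → C y ≡ true → x ≢ y → adj G x y ≡ true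

Simplicial : ∀ {n} → Graph n → Fin n → Set
Simplicial G w = Clique G (adj G w)

NonNeighbour : ∀ {n} → Graph n → Fin n → Fin n → Set
NonNeighbour G a x = a ≢ x × adj G a x ≡ false

module _ {n} (G : Graph n) where

  adj-flip : ∀ {x y b} → adj G x y ≡ b → adj G y x ≡ b
  adj-flip {x} {y} = trans (sym G y x)

  adj-separates : ∀ {a x y} → adj G a x ≡ true → adj G a y ≡ false → x ≢ y
  adj-separates a~x a≁y refl with () ← trans (≡-sym a~x) a≁y

  adj⇒≢ : ∀ {x y} → adj G x y ≡ true → x ≢ y
  adj⇒≢ {x} x~y refl = adj-separates x~y (irref G x) refl

  ¬NonNeighbour⇒adj : ∀ {a x} → a ≢ x → ¬ NonNeighbour G a x → adj G a x ≡ true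
  ¬NonNeighbour⇒adj a≢x ¬x∉Na = Bool.¬-not λ a≁x → ¬x∉Na (a≢x , a≁x)

  nonNeighbour? : ∀ a x → Dec (NonNeighbour G a x)
  nonNeighbour? a x = ¬? (a Fin.≟ x) ×-dec adj G a x Bool.≟ false

three-elements⇒3≤∣p∣ : ∀ {n} {p : Subset n} {x y z} → x ∈ₛ p → y ∈ₛ p → z ∈ₛ p →
                        x ≢ y → x ≢ z → y ≢ z → 3 ≤ ∣ p ∣
three-elements⇒3≤∣p∣ {p = p} {x} {y} {z} x∈p y∈p z∈p x≢y x≢z y≢z = begin
  3                      ≤⟨ s≤s (s≤s (s≤s z≤n)) ⟩
  3 + ∣ p - x - y - z ∣  ≤⟨ s≤s (s≤s (Subset.x∈p⇒∣p-x∣<∣p∣ z∈p-x-y)) ⟩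
  2 + ∣ p - x - y ∣      ≤⟨ s≤s (Subset.x∈p⇒∣p-x∣<∣p∣ y∈p-x) ⟩
  1 + ∣ p - x ∣          ≤⟨ Subset.x∈p⇒∣p-x∣<∣p∣ x∈p ⟩
  ∣ p ∣                  ∎
  where
  open ℕ.≤-Reasoning
  y∈p-x = Subset.x∈p∧x≢y⇒x∈p-y y∈p (≢-sym x≢y)
  z∈p-x-y = Subset.x∈p∧x≢y⇒x∈p-y (Subset.x∈p∧x≢y⇒x∈p-y z∈p (≢-sym x≢z)) (≢-sym y≢z)

module _ {n} (G : Graph n) (α≤2 : αAtMost G 2) where

  α≤2⇒nonNeighbours-adjacent : ∀ {a x y} → NonNeighbour G a x → NonNeighbour G a y → x ≢ y →
                               adj G x y ≡ true
  α≤2⇒nonNeighbours-adjacent {a} {x} {y} (a≢x , a≁x) (a≢y , a≁y) x≢y =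
    Bool.¬-not λ x≁y → ℕ.1+n≰n (ℕ.≤-trans (three-elements⇒3≤∣p∣ a∈S x∈S y∈S a≢x a≢y x≢y)
                                           (α≤2 S (independent x≁y)))
    where
    S : Subset n
    S = ⁅ a ⁆ ∪ (⁅ x ⁆ ∪ ⁅ y ⁆)

    a∈S : a ∈ₛ S
    a∈S = Subset.x∈p∪q⁺ (inj₁ (Subset.x∈⁅x⁆ a))
    x∈S : x ∈ₛ S
    x∈S = Subset.x∈p∪q⁺ (inj₂ (Subset.x∈p∪q⁺ (inj₁ (Subset.x∈⁅x⁆ x))))
    y∈S : y ∈ₛ S
    y∈S = Subset.x∈p∪q⁺ (inj₂ (Subset.x∈p∪q⁺ (inj₂ (Subset.x∈⁅x⁆ y))))

    ∈S⇒ : ∀ {w} → w ∈ₛ S → w ≡ a ⊎ w ≡ x ⊎ w ≡ y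
    ∈S⇒ w∈S with Subset.x∈p∪q⁻ ⁅ a ⁆ _ w∈S
    ... | inj₁ w∈a = inj₁ (Subset.x∈⁅y⁆⇒x≡y _ w∈a)
    ... | inj₂ w∈xy with Subset.x∈p∪q⁻ ⁅ x ⁆ ⁅ y ⁆ w∈xy
    ...   | inj₁ w∈x = inj₂ (inj₁ (Subset.x∈⁅y⁆⇒x≡y _ w∈x))
    ...   | inj₂ w∈y = inj₂ (inj₂ (Subset.x∈⁅y⁆⇒x≡y _ w∈y))

    independent : adj G x y ≡ false → Independent G S
    independent x≁y u w u∈S w∈S = pair (∈S⇒ u∈S) (∈S⇒ w∈S)
      where
      pair : ∀ {u w} → u ≡ a ⊎ u ≡ x ⊎ u ≡ y → w ≡ a ⊎ w ≡ x ⊎ w ≡ y → adj G u w ≡ false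
      pair (inj₁ refl)        (inj₁ refl)        = irref G a
      pair (inj₁ refl)        (inj₂ (inj₁ refl)) = a≁x
      pair (inj₁ refl)        (inj₂ (inj₂ refl)) = a≁y
      pair (inj₂ (inj₁ refl)) (inj₁ refl)        = adj-flip G a≁x
      pair (inj₂ (inj₁ refl)) (inj₂ (inj₁ refl)) = irref G x
      pair (inj₂ (inj₁ refl)) (inj₂ (inj₂ refl)) = x≁y
      pair (inj₂ (inj₂ refl)) (inj₁ refl)        = adj-flip G a≁y
      pair (inj₂ (inj₂ refl)) (inj₂ (inj₁ refl)) = adj-flip G x≁y
      pair (inj₂ (inj₂ refl)) (inj₂ (inj₂ refl)) = irref G y

-- CycAdj k i j unfolds to CycAdjℕ k (toℕ i) (toℕ j).
CycAdjℕ : ℕ → ℕ → ℕ → Set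
CycAdjℕ k s t = (suc s ≡ t) ⊎ (suc t ≡ s) ⊎ ((s ≡ 0 × suc t ≡ k) ⊎ (t ≡ 0 × suc s ≡ k))

cycAdj? : ∀ k (i j : Fin k) → Dec (CycAdj k i j)
cycAdj? k i j = let s = toℕ i; t = toℕ j in
  suc s ℕ.≟ t ⊎-dec suc t ℕ.≟ s ⊎-dec (s ℕ.≟ 0 ×-dec suc t ℕ.≟ k) ⊎-dec (t ℕ.≟ 0 ×-dec suc s ℕ.≟ k)

cycleAdj : ∀ k → Fin k → Fin k → Bool
cycleAdj k i j = does (cycAdj? k i j)

CycAdj-sym : ∀ {k} {i j : Fin k} → CycAdj k i j → CycAdj k j i
CycAdj-sym (inj₁ e)               = inj₂ (inj₁ e)
CycAdj-sym (inj₂ (inj₁ e))        = inj₁ e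
CycAdj-sym (inj₂ (inj₂ (inj₁ e))) = inj₂ (inj₂ (inj₂ e))
CycAdj-sym (inj₂ (inj₂ (inj₂ e))) = inj₂ (inj₂ (inj₁ e))

cycleAdj-sym : ∀ k (i j : Fin k) → cycleAdj k i j ≡ cycleAdj k j i
cycleAdj-sym k i j = does-⇔ (mk⇔ CycAdj-sym CycAdj-sym) (cycAdj? k i j) (cycAdj? k j i)

CycAdj-irrefl : ∀ {m} (i : Fin (4 + m)) → ¬ CycAdj (4 + m) i i
CycAdj-irrefl _       (inj₁ e)                      = ℕ.1+n≢n e
CycAdj-irrefl _       (inj₂ (inj₁ e))               = ℕ.1+n≢n e
CycAdj-irrefl zero    (inj₂ (inj₂ (inj₁ (_ , ()))))
CycAdj-irrefl zero    (inj₂ (inj₂ (inj₂ (_ , ()))))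
CycAdj-irrefl (suc _) (inj₂ (inj₂ (inj₁ (() , _))))
CycAdj-irrefl (suc _) (inj₂ (inj₂ (inj₂ (() , _))))

-- The two neighbours of t are t - 1 and t + 1 modulo 4 + m.
cycle-neighboursℕ : ∀ m t → t < 4 + m → Σ ℕ λ s → Σ ℕ λ u →
                    s < 4 + m × u < 4 + m × CycAdjℕ (4 + m) t s × CycAdjℕ (4 + m) t u ×
                    ¬ CycAdjℕ (4 + m) s u × s ≢ u
cycle-neighboursℕ m zero _ =
  1 , 3 + m , s≤s (s≤s z≤n) , ℕ.n<1+n _ , inj₁ refl , inj₂ (inj₂ (inj₁ (refl , refl))) ,
  (λ { (inj₁ ()) ; (inj₂ (inj₁ ())) ; (inj₂ (inj₂ (inj₁ (() , _)))) ; (inj₂ (inj₂ (inj₂ (() , _)))) }) ,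
  λ ()
cycle-neighboursℕ m (suc s) t<k with 2 + s ℕ.≟ 4 + m
... | yes refl =
  s , 0 , ℕ.<⇒≤ t<k , s≤s z≤n , inj₂ (inj₁ refl) , inj₂ (inj₂ (inj₂ (refl , refl))) ,
  (λ { (inj₂ (inj₂ (inj₂ (_ , e)))) → ℕ.1+n≢n (≡-sym e) }) ,
  λ ()
... | no t+1≢k =
  s , 2 + s , ℕ.<⇒≤ t<k , ℕ.≤∧≢⇒< t<k t+1≢k , inj₂ (inj₁ refl) , inj₁ refl ,
  (λ { (inj₁ e) → ℕ.m≢1+n+m (suc s) {0} e
     ; (inj₂ (inj₁ e)) → ℕ.m≢1+n+m s {2} (≡-sym e)
     ; (inj₂ (inj₂ (inj₁ (refl , ())))) }) ,
  ℕ.m≢1+n+m s {1}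

cycle-neighbours : ∀ m (i : Fin (4 + m)) → Σ (Fin (4 + m)) λ j → Σ (Fin (4 + m)) λ l →
                   CycAdj (4 + m) i j × CycAdj (4 + m) i l × ¬ CycAdj (4 + m) j l × j ≢ l
cycle-neighbours m i with cycle-neighboursℕ m (toℕ i) (Fin.toℕ<n i)
... | s , u , s<k , u<k , i~s , i~u , s≁u , s≢u =
  fromℕ< s<k , fromℕ< u<k ,
  subst (CycAdjℕ (4 + m) (toℕ i)) (≡-sym toℕ-j) i~s ,
  subst (CycAdjℕ (4 + m) (toℕ i)) (≡-sym toℕ-l) i~u ,
  s≁u ∘ subst₂ (CycAdjℕ (4 + m)) toℕ-j toℕ-l ,
  s≢u ∘ subst₂ _≡_ toℕ-j toℕ-l ∘ cong toℕ
  where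
  toℕ-j = Fin.toℕ-fromℕ< s<k
  toℕ-l = Fin.toℕ-fromℕ< u<k

-- Recognising and transferring induced cycles

AdjMatches : ∀ {n} → Graph n → Fin n → Fin n → Bool → Set
AdjMatches G x y true  = adj G x y ≡ true
AdjMatches G x y false = adj G x y ≡ false × x ≢ y

-- Only the pairs of positions i < j are listed; non-adjacent pairs must also be distinct,
-- which makes the cycle injective.
InducesCycle : ∀ {n k} → Graph n → Vec (Fin n) k → Set
InducesCycle {k = k} G xs =
  ∀ j (i : Fin′ j) → AdjMatches G (lookup xs (inject i)) (lookup xs j) (cycleAdj k (inject i) j)

module _ {n} (G : Graph n) where

  adjMatches⇒adj≡ : ∀ {x y} b → AdjMatches G x y b → adj G x y ≡ b
  adjMatches⇒adj≡ true  x~y       = x~y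
  adjMatches⇒adj≡ false (x≁y , _) = x≁y

  adjMatches⇒≢ : ∀ {x y} b → AdjMatches G x y b → x ≢ y
  adjMatches⇒≢ true  x~y       = adj⇒≢ G x~y
  adjMatches⇒≢ false (_ , x≢y) = x≢y

  inducedCycle : ∀ {m} (xs : Vec (Fin n) (4 + m)) → InducesCycle G xs → InducedCycle G (4 + m)
  inducedCycle {m} xs upper = c , injective , λ i j →
    mk⇔ (λ c~c → Equivalence.to (does≡true⇔ (cycAdj? k i j)) (trans (≡-sym (adj-c i j)) c~c))
        (λ i~j → trans (adj-c i j) (Equivalence.from (does≡true⇔ (cycAdj? k i j)) i~j))
    where
    k = 4 + m
    c = lookup xs

    adj-c : ∀ i j → adj G (c i) (c j) ≡ cycleAdj k i j
    adj-c i j with compare i j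
    ... | less j i′    = adjMatches⇒adj≡ _ (upper j i′)
    ... | equal i      = trans (irref G (c i)) (≡-sym (dec-false (cycAdj? k i i) (CycAdj-irrefl i)))
    ... | greater i j′ = begin
      adj G (c i) (c (inject j′))   ≡⟨ adj-flip G refl ⟩
      adj G (c (inject j′)) (c i)   ≡⟨ adjMatches⇒adj≡ _ (upper i j′) ⟩
      cycleAdj k (inject j′) i      ≡⟨ cycleAdj-sym k (inject j′) i ⟩
      cycleAdj k i (inject j′)      ∎
      where open ≡-Reasoning

    injective : Injective _≡_ _≡_ c
    injective {i} {j} c≡c with compare i j
    ... | less j i′    = contradiction c≡c (adjMatches⇒≢ _ (upper j i′))
    ... | equal _      = refl
    ... | greater i j′ = contradiction (≡-sym c≡c) (adjMatches⇒≢ _ (upper i j′))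

InducedCycle-transfer : ∀ {m n k} (G : Graph n) (H : Graph m) (C : InducedCycle G k) (d : Fin k → Fin m) →
                        (∀ {i j} → d i ≡ d j → proj₁ C i ≡ proj₁ C j) →
                        (∀ i j → adj H (d i) (d j) ≡ adj G (proj₁ C i) (proj₁ C j)) → InducedCycle H k
InducedCycle-transfer _ _ (_ , injective , iff) d d≡⇒c≡ adj≡ =
  d , injective ∘ d≡⇒c≡ , λ i j → subst (λ b → (b ≡ true) ⇔ _) (≡-sym (adj≡ i j)) (iff i j)

record InducedEmbedding {m n} (H : Graph m) (G : Graph n) : Set where
  field
    embed           : Fin m → Fin n
    embed-injective : Injective _≡_ _≡_ embed
    adj-embed       : ∀ x y → adj G (embed x) (embed y) ≡ adj H x y

module _ {m n} {H : Graph m} {G : Graph n} (e : InducedEmbedding H G) where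
  open InducedEmbedding e

  Chordal-induced : Chordal G → Chordal H
  Chordal-induced chordal (l , C@(c , _)) =
    chordal (l , InducedCycle-transfer H G C (embed ∘ c) embed-injective (λ i j → adj-embed (c i) (c j)))

  InducedCycle-restrict : ∀ {k} (C : InducedCycle G k) → (∀ i → Σ (Fin m) λ x → embed x ≡ proj₁ C i) →
                          InducedCycle H k
  InducedCycle-restrict C preimage = InducedCycle-transfer G H C (proj₁ ∘ preimage)
    (λ {i} {j} x≡y → trans (≡-sym (proj₂ (preimage i))) (trans (cong embed x≡y) (proj₂ (preimage j))))
    (λ i j → trans (≡-sym (adj-embed _ _)) (cong₂ (adj G) (proj₂ (preimage i)) (proj₂ (preimage j))))

module _ {n} (G : Graph (suc n)) (v : Fin (suc n)) where

  delete-embedding : InducedEmbedding (delete G v) G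
  delete-embedding = record
    { embed           = punchIn v
    ; embed-injective = Fin.punchIn-injective v _ _
    ; adj-embed       = λ _ _ → refl
    }

  split-embedding : ∀ A B → InducedEmbedding (delete G v) (split G v A B)
  split-embedding A B = record
    { embed           = λ x → suc (suc x)
    ; embed-injective = Fin.suc-injective ∘ Fin.suc-injective
    ; adj-embed       = λ _ _ → refl
    }

  InducedCycle-avoiding : ∀ {k} (C : InducedCycle G k) → (∀ i → proj₁ C i ≢ v) → InducedCycle (delete G v) k
  InducedCycle-avoiding C avoids = InducedCycle-restrict delete-embedding C λ i →
    punchOut (≢-sym (avoids i)) , Fin.punchIn-punchOut (≢-sym (avoids i))

-- Splitting along two cliques

simplicial∉InducedCycle : ∀ {n m} (G : Graph n) {w} → Simplicial G w →
                          (C : InducedCycle G (4 + m)) → ∀ i → proj₁ C i ≢ w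
simplicial∉InducedCycle {m = m} _ simplicial (c , injective , iff) i refl with cycle-neighbours m i
... | j , l , i~j , i~l , j≁l , j≢l = j≁l (Equivalence.to (iff j l)
  (simplicial (c j) (c l) (Equivalence.from (iff i j) i~j) (Equivalence.from (iff i l) i~l) (j≢l ∘ injective)))

module _ {n} (G : Graph (suc n)) (v : Fin (suc n)) (A B : Fin (suc n) → Bool) where

  private
    old-distinct : ∀ {x y : Fin n} → Fin.suc (suc x) ≢ suc (suc y) → punchIn v x ≢ punchIn v y
    old-distinct x≢y = x≢y ∘ cong (λ x → suc (suc x)) ∘ Fin.punchIn-injective v _ _

  split-simplicial₁ : Clique G A → Simplicial (split G v A B) zero
  split-simplicial₁ A-clique (suc (suc x)) (suc (suc y)) Ax Ay x≢y = A-clique _ _ Ax Ay (old-distinct x≢y)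
  split-simplicial₁ _ zero          _             ()
  split-simplicial₁ _ (suc zero)    _             ()
  split-simplicial₁ _ (suc (suc _)) zero          _  ()
  split-simplicial₁ _ (suc (suc _)) (suc zero)    _  ()

  split-simplicial₂ : Clique G B → Simplicial (split G v A B) (suc zero)
  split-simplicial₂ B-clique (suc (suc x)) (suc (suc y)) Bx By x≢y = B-clique _ _ Bx By (old-distinct x≢y)
  split-simplicial₂ _ zero          _             ()
  split-simplicial₂ _ (suc zero)    _             ()
  split-simplicial₂ _ (suc (suc _)) zero          _  ()
  split-simplicial₂ _ (suc (suc _)) (suc zero)    _  ()

  split-chordal : Chordal (delete G v) → Clique G A → Clique G B → Chordal (split G v A B)
  split-chordal chordal A-clique B-clique (m , C) =
    chordal (m , InducedCycle-restrict (split-embedding G v A B) C old)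
    where
    old : ∀ i → Σ (Fin n) λ x → suc (suc x) ≡ proj₁ C i
    old i with proj₁ C i in c≡
    ... | zero        = ⊥-elim (simplicial∉InducedCycle (split G v A B) (split-simplicial₁ A-clique) C i c≡)
    ... | suc zero    = ⊥-elim (simplicial∉InducedCycle (split G v A B) (split-simplicial₂ B-clique) C i c≡)
    ... | suc (suc x) = x , refl

-- Covering the neighbourhood of v by two cliques

module NeighbourhoodCover {n} {G : Graph (suc n)} {v : Fin (suc n)}
  (α≤2 : αAtMost G 2) (chordal : Chordal (delete G v)) where

  N : Fin (suc n) → Set
  N x = adj G v x ≡ true

  N? : ∀ x → Dec (N x)
  N? x = adj G v x Bool.≟ true

  no-InducedCycle-in-N : ∀ {m} (xs : Vec (Fin (suc n)) (4 + m)) → All N xs → ¬ InducesCycle G xs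
  no-InducedCycle-in-N xs xs⊆N cycle = chordal (_ , InducedCycle-avoiding G v (inducedCycle G xs cycle)
    λ i → ≢-sym (adj⇒≢ G (lookup⁺ xs⊆N i)))

  common-neighbours-adjacent : ∀ {a b x y} → N a → N b → N x → N y → NonNeighbour G a b → x ≢ y →
                               adj G a x ≡ true → adj G b x ≡ true → adj G a y ≡ true → adj G b y ≡ true →
                               adj G x y ≡ true
  common-neighbours-adjacent {a} {b} {x} {y} va vb vx vy (a≢b , a≁b) x≢y a~x b~x a~y b~y =
    Bool.¬-not λ x≁y → no-InducedCycle-in-N (x ∷ a ∷ y ∷ b ∷ []) (vx ∷ va ∷ vy ∷ vb ∷ []) (square x≁y)
    where
    square : adj G x y ≡ false → InducesCycle G (x ∷ a ∷ y ∷ b ∷ [])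
    square x≁y (suc zero)             zero             = adj-flip G a~x
    square x≁y (suc (suc zero))       zero             = x≁y , x≢y
    square x≁y (suc (suc zero))       (suc zero)       = a~y
    square x≁y (suc (suc (suc zero))) zero             = adj-flip G b~x
    square x≁y (suc (suc (suc zero))) (suc zero)       = a≁b , a≢b
    square x≁y (suc (suc (suc zero))) (suc (suc zero)) = adj-flip G b~y

  module _ {a b} (va : N a) (vb : N b) (b∉Na : NonNeighbour G a b) where

    private
      a≢b = proj₁ b∉Na
      a≁b = proj₂ b∉Na

    SeesAll : Fin (suc n) → Set
    SeesAll x = ∀ p → N p → NonNeighbour G a p → adj G x p ≡ true

    Misses : Fin (suc n) → Set
    Misses x = Σ (Fin (suc n)) λ p → N p × NonNeighbour G a p × adj G x p ≡ false

    ASide : Fin (suc n) → Set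
    ASide x = NonNeighbour G a x ⊎ (adj G a x ≡ true × adj G b x ≡ true × SeesAll x)

    aSide? : ∀ x → Dec (ASide x)
    aSide? x = nonNeighbour? G a x ⊎-dec adj G a x Bool.≟ true ×-dec adj G b x Bool.≟ true ×-dec
               Fin.all? λ p → N? p →-dec nonNeighbour? G a p →-dec adj G x p Bool.≟ true

    A B : Fin (suc n) → Bool
    A x = adj G v x ∧ does (aSide? x)
    B x = adj G v x ∧ does (¬? (aSide? x))

    AB-split : SplitSets G v A B
    AB-split x = ∧-∨-∧-not (adj G v x) (does (aSide? x))

    A-clique : Clique G A
    A-clique x y Ax Ay x≢y with ∧-does≡true _ (aSide? x) Ax | ∧-does≡true _ (aSide? y) Ay
    ... | _  , inj₁ x∉Na             | _  , inj₁ y∉Na             = α≤2⇒nonNeighbours-adjacent G α≤2 x∉Na y∉Na x≢y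
    ... | vx , inj₁ x∉Na             | _  , inj₂ (_ , _ , y-sees) = adj-flip G (y-sees x vx x∉Na)
    ... | _  , inj₂ (_ , _ , x-sees) | vy , inj₁ y∉Na             = x-sees y vy y∉Na
    ... | vx , inj₂ (a~x , b~x , _)  | vy , inj₂ (a~y , b~y , _)  =
      common-neighbours-adjacent va vb vx vy b∉Na x≢y a~x b~x a~y b~y

    BSide : Fin (suc n) → Set
    BSide x = NonNeighbour G b x ⊎ (adj G a x ≡ true × adj G b x ≡ true × Misses x)

    ¬ASide⇒BSide : ∀ {x} → ¬ ASide x → BSide x
    ¬ASide⇒BSide {x} ¬side with nonNeighbour? G b x
    ... | yes x∉Nb = inj₁ x∉Nb
    ... | no ¬x∉Nb = inj₂ (a~x , b~x , decidable-stable (Fin.any? misses?) λ ¬misses →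
                       ¬side (inj₂ (a~x , b~x , λ p vp p∉Na → Bool.¬-not λ x≁p → ¬misses (p , vp , p∉Na , x≁p))))
      where
      a~x = ¬NonNeighbour⇒adj G (λ { refl → ¬x∉Nb (≢-sym a≢b , adj-flip G a≁b) }) (¬side ∘ inj₁)
      b~x = ¬NonNeighbour⇒adj G (λ { refl → ¬side (inj₁ b∉Na) }) ¬x∉Nb

      misses? : ∀ p → Dec (N p × NonNeighbour G a p × adj G x p ≡ false)
      misses? p = N? p ×-dec nonNeighbour? G a p ×-dec adj G x p Bool.≟ false

    nonNeighbour-misser-adjacent : ∀ {x y} → N x → N y → NonNeighbour G b x →
                                   adj G a y ≡ true → adj G b y ≡ true → Misses y → x ≢ y → adj G x y ≡ true
    nonNeighbour-misser-adjacent {x} {y} vx vy (b≢x , b≁x) a~y b~y (p , vp , (a≢p , a≁p) , y≁p) x≢y =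
      Bool.¬-not λ x≁y → no-InducedCycle-in-N (y ∷ a ∷ x ∷ p ∷ b ∷ []) (vy ∷ va ∷ vx ∷ vp ∷ vb ∷ [])
                                                (pentagon x≁y)
      where
      pentagon : adj G x y ≡ false → InducesCycle G (y ∷ a ∷ x ∷ p ∷ b ∷ [])
      pentagon x≁y = table
        where
        y≢p = adj-separates G a~y a≁p
        a~x = α≤2⇒nonNeighbours-adjacent G α≤2 (≢-sym a≢b , adj-flip G a≁b) (b≢x , b≁x)
                (adj-separates G (adj-flip G a~y) (adj-flip G x≁y))
        x~p = α≤2⇒nonNeighbours-adjacent G α≤2 (≢-sym x≢y , adj-flip G x≁y) (y≢p , y≁p)
                (adj-separates G a~x a≁p)
        p~b = α≤2⇒nonNeighbours-adjacent G α≤2 (a≢p , a≁p) (a≢b , a≁b)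
                (≢-sym (adj-separates G (adj-flip G b~y) y≁p))

        table : InducesCycle G (y ∷ a ∷ x ∷ p ∷ b ∷ [])
        table (suc zero)                   zero                   = adj-flip G a~y
        table (suc (suc zero))             zero                   = adj-flip G x≁y , ≢-sym x≢y
        table (suc (suc zero))             (suc zero)             = a~x
        table (suc (suc (suc zero)))       zero                   = y≁p , y≢p
        table (suc (suc (suc zero)))       (suc zero)             = a≁p , a≢p
        table (suc (suc (suc zero)))       (suc (suc zero))       = x~p
        table (suc (suc (suc (suc zero)))) zero                   = adj-flip G b~y
        table (suc (suc (suc (suc zero)))) (suc zero)             = a≁b , a≢b
        table (suc (suc (suc (suc zero)))) (suc (suc zero))       = adj-flip G b≁x , ≢-sym b≢x
        table (suc (suc (suc (suc zero)))) (suc (suc (suc zero))) = p~b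

    B-clique : Clique G B
    B-clique x y Bx By x≢y with ∧-does≡true _ (¬? (aSide? x)) Bx | ∧-does≡true _ (¬? (aSide? y)) By
    ... | vx , ¬x | vy , ¬y with ¬ASide⇒BSide ¬x | ¬ASide⇒BSide ¬y
    ...   | inj₁ x∉Nb                   | inj₁ y∉Nb                   =
      α≤2⇒nonNeighbours-adjacent G α≤2 x∉Nb y∉Nb x≢y
    ...   | inj₁ x∉Nb                   | inj₂ (a~y , b~y , y-misses) =
      nonNeighbour-misser-adjacent vx vy x∉Nb a~y b~y y-misses x≢y
    ...   | inj₂ (a~x , b~x , x-misses) | inj₁ y∉Nb                   =
      adj-flip G (nonNeighbour-misser-adjacent vy vx y∉Nb a~x b~x x-misses (≢-sym x≢y))
    ...   | inj₂ (a~x , b~x , _)        | inj₂ (a~y , b~y , _)        =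
      common-neighbours-adjacent va vb vx vy b∉Na x≢y a~x b~x a~y b~y

  two-clique-cover : Σ (Fin (suc n) → Bool) λ A → Σ (Fin (suc n) → Bool) λ B →
                     SplitSets G v A B × Clique G A × Clique G B
  two-clique-cover with Fin.any? (λ a → Fin.any? λ b → N? a ×-dec N? b ×-dec nonNeighbour? G a b)
  ... | yes (a , b , va , vb , b∉Na) = A va vb b∉Na , B va vb b∉Na , AB-split va vb b∉Na ,
                                        A-clique va vb b∉Na , B-clique va vb b∉Na
  ... | no ¬non-edge = adj G v , (λ _ → false) , (λ x → Bool.∨-identityʳ (adj G v x)) , N-clique , λ _ _ ()
    where
    N-clique : Clique G (adj G v)
    N-clique x y vx vy x≢y = Bool.¬-not λ x≁y → ¬non-edge (x , y , vx , vy , x≢y , x≁y)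

module _ {n} {G : Graph n} where

  ChVDAtMost-zero⇒Chordal : ChVDAtMost G 0 → Chordal G
  ChVDAtMost-zero⇒Chordal (done chordal) = chordal

  ChVSAtMost-zero⇒Chordal : ChVSAtMost G 0 → Chordal G
  ChVSAtMost-zero⇒Chordal (done chordal) = chordal

  ChVDEq-suc⇒¬Chordal : ∀ {k} → ChVDEq G (suc k) → ¬ Chordal G
  ChVDEq-suc⇒¬Chordal (_ , minimal) = minimal 0 (s≤s z≤n) ∘ done

  ChVSEq-suc⇒¬Chordal : ∀ {k} → ChVSEq G (suc k) → ¬ Chordal G
  ChVSEq-suc⇒¬Chordal (_ , minimal) = minimal 0 (s≤s z≤n) ∘ done

  ¬Chordal⇒ChVD-minimal : ¬ Chordal G → ∀ j → suc j ≤ 1 → ¬ ChVDAtMost G j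
  ¬Chordal⇒ChVD-minimal ¬chordal zero    _         = ¬chordal ∘ ChVDAtMost-zero⇒Chordal
  ¬Chordal⇒ChVD-minimal _        (suc _) (s≤s ())

  ¬Chordal⇒ChVS-minimal : ¬ Chordal G → ∀ j → suc j ≤ 1 → ¬ ChVSAtMost G j
  ¬Chordal⇒ChVS-minimal ¬chordal zero    _         = ¬chordal ∘ ChVSAtMost-zero⇒Chordal
  ¬Chordal⇒ChVS-minimal _        (suc _) (s≤s ())

ChVD≡1⇒ChVS≡1 : ∀ {n} {G : Graph n} → αAtMost G 2 → ChVDEq G 1 → ChVSEq G 1
ChVD≡1⇒ChVS≡1 α≤2 eq@(done chordal , _) = ⊥-elim (ChVDEq-suc⇒¬Chordal eq chordal)
ChVD≡1⇒ChVS≡1 {G = G} α≤2 eq@(step v deleted , _)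
  with NeighbourhoodCover.two-clique-cover {G = G} {v} α≤2 (ChVDAtMost-zero⇒Chordal deleted)
... | A , B , AB , A-clique , B-clique =
  step v A B AB (done (split-chordal G v A B (ChVDAtMost-zero⇒Chordal deleted) A-clique B-clique)) ,
  ¬Chordal⇒ChVS-minimal (ChVDEq-suc⇒¬Chordal eq)

ChVS≡1⇒ChVD≡1 : ∀ {n} {G : Graph n} → ChVSEq G 1 → ChVDEq G 1
ChVS≡1⇒ChVD≡1 eq@(done chordal , _) = ⊥-elim (ChVSEq-suc⇒¬Chordal eq chordal)
ChVS≡1⇒ChVD≡1 {G = G} eq@(step v A B _ split , _) =
  step v (done (Chordal-induced (split-embedding G v A B) (ChVSAtMost-zero⇒Chordal split))) ,
  ¬Chordal⇒ChVD-minimal (ChVSEq-suc⇒¬Chordal eq)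

theorem6 : ∀ {n} (G : Graph n) → αAtMost G 2 →
             (ChVDEq G 1 → ChVSEq G 1) × (ChVSEq G 1 → ChVDEq G 1)
theorem6 G α≤2 = ChVD≡1⇒ChVS≡1 α≤2 , ChVS≡1⇒ChVD≡1
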